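{- Let $G$ be a graph, $P=K_3\times G$, $0\le\epsilon\le 1/3$, and let $H$ be $\epsilon$-near $P$ via a deleted edge set $E'$ and bijection $\psi$. Let $u,v\in V(H)$ with $|\Gamma_H(u)|\ge|\Gamma_H(v)|$, and write $\psi(u)=(t_1,g_1)$, $\psi(v)=(t_2,g_2)$. Then \[ |I_{K_3}(t_1,t_2)|\cdot|I_G(g_1,g_2)|-3\epsilon|\Gamma_H(u)|\le|I_H(u,v)|\le|I_{K_3}(t_1,t_2)|\cdot|I_G(g_1,g_2)|. \]
   Context: Graphs are finite, undirected, simple, loopless. $\Gamma_X(v)$ is the neighbourhood of $v$ in graph $X$ and $I_X(u,v)=\Gamma_X(u)\cap\Gamma_X(v)$. The tensor product $F\times G$ has vertex set $V(F)\times V(G)$, with $(f,g)$, $(f',g')$ adjacent iff $\{f,f'\}\in E(F)$ and $\{g,g'\}\in E(G)$. $K_3$ is the complete graph on $\{a,b,c\}$. $H$ is $\epsilon$-near $P=K_3\times G$ means: there is $E'\subseteq E(P)$ such that each vertex $w$ of $P$ has at most $\epsilon|\Gamma_P(w)|$ incident edges in $E'$, and a bijection $\psi:V(H)\to V(P)$ which is a graph isomorphism from $H$ onto $(V(P),E(P)\setminus E')$.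
   Formalization: The parameter ε ranges over the rationals with $0\le\epsilon\le 1/3$, both in the hypothesis of ε-nearness and in the lower bound. -}

module Defs where

open import Data.Nat using (ℕ; zero; suc; _+_)
open import Data.Fin using (Fin; zero; suc; _≟_)
open import Data.Bool using (Bool; true; false; _∧_; not; if_then_else_)
open import Data.Product using (_×_; _,_)
open import Data.Integer using (+_)
open import Data.Rational using (ℚ; _/_; _≤_; _*_)
open import Relation.Nullary.Decidable using (⌊_⌋)
open import Relation.Binary.PropositionalEquality using (_≡_)
open import Function.Bundles using (Bijection; _⤖_)

record Graph : Set where
  field
    n      : ℕ
    adj    : Fin n → Fin n → Bool
    sym    : ∀ u v → adj u v ≡ adj v u
    irrefl : ∀ v → adj v v ≡ false
open Graph public

sumF : ∀ {k} → (Fin k → ℕ) → ℕ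
sumF {zero}  f = 0
sumF {suc k} f = f zero + sumF (λ i → f (suc i))

count : ∀ {k} → (Fin k → Bool) → ℕ
count p = sumF (λ i → if p i then 1 else 0)

deg : (X : Graph) → Fin (n X) → ℕ
deg X v = count (adj X v)

common : (X : Graph) → Fin (n X) → Fin (n X) → ℕ
common X u v = count (λ w → adj X u w ∧ adj X v w)

K3 : Graph
K3 = record
  { n = 3
  ; adj = λ i j → not ⌊ i ≟ j ⌋
  ; sym = symK
  ; irrefl = irrK
  }
  where
  symK : ∀ (u v : Fin 3) → not ⌊ u ≟ v ⌋ ≡ not ⌊ v ≟ u ⌋
  symK zero zero = _≡_.refl
  symK zero (suc zero) = _≡_.refl
  symK zero (suc (suc zero)) = _≡_.refl
  symK (suc zero) zero = _≡_.refl
  symK (suc zero) (suc zero) = _≡_.refl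
  symK (suc zero) (suc (suc zero)) = _≡_.refl
  symK (suc (suc zero)) zero = _≡_.refl
  symK (suc (suc zero)) (suc zero) = _≡_.refl
  symK (suc (suc zero)) (suc (suc zero)) = _≡_.refl
  irrK : ∀ (v : Fin 3) → not ⌊ v ≟ v ⌋ ≡ false
  irrK zero = _≡_.refl
  irrK (suc zero) = _≡_.refl
  irrK (suc (suc zero)) = _≡_.refl

VP : Graph → Set
VP G = Fin 3 × Fin (n G)

adjP : (G : Graph) → VP G → VP G → Bool
adjP G (t , g) (t' , g') = adj K3 t t' ∧ adj G g g'

countP : (G : Graph) → (VP G → Bool) → ℕ
countP G p = sumF (λ t → count (λ g → p (t , g)))

degP : (G : Graph) → VP G → ℕ
degP G w = countP G (adjP G w)

ℕtoℚ : ℕ → ℚ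
ℕtoℚ k = (+ k) / 1

record NearVia (G : Graph) (ε : ℚ) (H : Graph)
               (E' : VP G → VP G → Bool) (ψ : Fin (n H) ⤖ VP G) : Set where
  field
    E'-sym    : ∀ x y → E' x y ≡ E' y x
    E'-sub    : ∀ x y → E' x y ≡ true → adjP G x y ≡ true
    E'-bound  : ∀ w → ℕtoℚ (countP G (E' w)) ≤ ε * ℕtoℚ (degP G w)
    ψ-iso     : ∀ u v → adj H u v ≡
                  (adjP G (Bijection.to ψ u) (Bijection.to ψ v)
                   ∧ not (E' (Bijection.to ψ u) (Bijection.to ψ v)))

{-# OPTIONS --safe #-}
-- In K₃ × G the common neighbours of (t₁ , g₁) and (t₂ , g₂) are exactly
-- I_K₃(t₁ , t₂) × I_G(g₁ , g₂), so |I_P| is the product of the two counts.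
-- Deleting E' only loses common neighbours, and every lost one is an
-- E'-neighbour of ψ u or of ψ v.  A vertex w with deg_H w ≤ deg_H u has
-- |E'(w)| ≤ ε deg_P w = ε (deg_H w + |E'(w)|), hence
-- |E'(w)| ≤ ε/(1-ε) · deg_H u ≤ (3/2) ε deg_H u because ε ≤ 1/3; the two
-- losses together cost at most 3 ε deg_H u.
module Submission where

module Counting where
  open import Data.Nat using (ℕ; zero; suc; _+_; _*_; _≤_; z≤n; s≤s)
  open import Data.Nat.Properties using (+-mono-≤; +-assoc; +-identityʳ; +-*-semiring)
  open import Data.Fin using (Fin; zero; suc; _↑ˡ_; _↑ʳ_; combine; remQuot)
  open import Data.Fin.Properties using (*↔×; remQuot-combine)
  open import Data.Fin.Permutation using (Permutation; _⟨$⟩ʳ_)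
  open import Data.Product using (_×_; _,_; proj₁; proj₂)
  open import Data.Bool using (Bool; true; false; _∧_; not; if_then_else_)
  open import Data.Bool.Properties using (∧-commutativeMonoid)
  open import Algebra.Bundles using (CommutativeMonoid)
  open import Algebra.Properties.CommutativeSemigroup
    (CommutativeMonoid.commutativeSemigroup ∧-commutativeMonoid) using (interchange)
  open import Function using (_∘_)
  open import Function.Bundles using (Bijection; _⤖_)
  open import Function.Properties.Bijection using (⤖⇒↔)
  open import Function.Construct.Composition using (_↔-∘_)
  open import Function.Construct.Symmetry using (↔-sym)
  open import Algebra.Properties.Semiring.Sum +-*-semiring
    using (sum; sum-cong-≗; ∑-distrib-+; *-distribˡ-sum; *-distribʳ-sum; sum-permute)
  open import Relation.Binary.PropositionalEquality
  open import Defs using (sumF)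

  sumF≡sum : ∀ {k} (f : Fin k → ℕ) → sumF f ≡ sum f
  sumF≡sum {zero}  f = refl
  sumF≡sum {suc k} f = cong (f zero +_) (sumF≡sum (f ∘ suc))

  sumF-cong : ∀ {k} {f g : Fin k → ℕ} → (∀ i → f i ≡ g i) → sumF f ≡ sumF g
  sumF-cong {f = f} {g} f≗g rewrite sumF≡sum f | sumF≡sum g = sum-cong-≗ f≗g

  sumF-+ : ∀ {k} (f g : Fin k → ℕ) → sumF (λ i → f i + g i) ≡ sumF f + sumF g
  sumF-+ f g rewrite sumF≡sum (λ i → f i + g i) | sumF≡sum f | sumF≡sum g = ∑-distrib-+ f g

  sumF-*ˡ : ∀ {k} a (f : Fin k → ℕ) → sumF (λ i → a * f i) ≡ a * sumF f
  sumF-*ˡ a f rewrite sumF≡sum (λ i → a * f i) | sumF≡sum f = sym (*-distribˡ-sum a f)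

  sumF-*ʳ : ∀ {k} a (f : Fin k → ℕ) → sumF (λ i → f i * a) ≡ sumF f * a
  sumF-*ʳ a f rewrite sumF≡sum (λ i → f i * a) | sumF≡sum f = sym (*-distribʳ-sum a f)

  sumF-mono : ∀ {k} {f g : Fin k → ℕ} → (∀ i → f i ≤ g i) → sumF f ≤ sumF g
  sumF-mono {zero}  f≤g = z≤n
  sumF-mono {suc k} f≤g = +-mono-≤ (f≤g zero) (sumF-mono (f≤g ∘ suc))

  sumF-↑ : ∀ a {b} (f : Fin (a + b) → ℕ) →
           sumF f ≡ sumF (λ i → f (i ↑ˡ b)) + sumF (λ j → f (a ↑ʳ j))
  sumF-↑ zero    f = refl
  sumF-↑ (suc a) f rewrite sumF-↑ a (f ∘ suc) = sym (+-assoc (f zero) _ _)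

  sumF-combine : ∀ a {b} (f : Fin (a * b) → ℕ) →
                 sumF f ≡ sumF {a} (λ i → sumF {b} (λ j → f (combine i j)))
  sumF-combine zero    f = refl
  sumF-combine (suc a) {b} f =
    trans (sumF-↑ b f) (cong (sumF (λ j → f (j ↑ˡ (a * b))) +_) (sumF-combine a (f ∘ (b ↑ʳ_))))

  sum× : ∀ {a b} → (Fin a × Fin b → ℕ) → ℕ
  sum× f = sumF (λ i → sumF (λ j → f (i , j)))

  sum×-mono : ∀ {a b} {f g : Fin a × Fin b → ℕ} → (∀ z → f z ≤ g z) → sum× f ≤ sum× g
  sum×-mono f≤g = sumF-mono (λ i → sumF-mono (λ j → f≤g (i , j)))

  sum×-+ : ∀ {a b} (f g : Fin a × Fin b → ℕ) → sum× (λ z → f z + g z) ≡ sum× f + sum× g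
  sum×-+ f g = trans (sumF-cong (λ i → sumF-+ (λ j → f (i , j)) (λ j → g (i , j))))
                     (sumF-+ (λ i → sumF (λ j → f (i , j))) (λ i → sumF (λ j → g (i , j))))

  sum×-* : ∀ {a b} (f : Fin a → ℕ) (g : Fin b → ℕ) →
           sum× (λ z → f (proj₁ z) * g (proj₂ z)) ≡ sumF f * sumF g
  sum×-* f g = trans (sumF-cong (λ i → sumF-*ˡ (f i) g)) (sumF-*ʳ (sumF g) f)

  sumF-∘-⤖ : ∀ {m a b} (ψ : Fin m ⤖ (Fin a × Fin b)) (f : Fin a × Fin b → ℕ) →
             sumF (f ∘ Bijection.to ψ) ≡ sum× f
  sumF-∘-⤖ {m} {a} {b} ψ f = begin
    sumF (f ∘ to)
      ≡⟨ sumF-cong (λ i → cong f (sym (remQuot-combine (proj₁ (to i)) (proj₂ (to i))))) ⟩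
    sumF (F ∘ (π ⟨$⟩ʳ_))
      ≡⟨ sumF≡sum (F ∘ (π ⟨$⟩ʳ_)) ⟩
    sum (F ∘ (π ⟨$⟩ʳ_))
      ≡⟨ sum-permute F π ⟨
    sum F
      ≡⟨ sumF≡sum F ⟨
    sumF F
      ≡⟨ sumF-combine a {b} F ⟩
    sumF {a} (λ i → sumF {b} (λ j → F (combine i j)))
      ≡⟨ sumF-cong (λ i → sumF-cong (λ j → cong f (remQuot-combine i j))) ⟩
    sum× f ∎
    where
    open ≡-Reasoning
    to = Bijection.to ψ
    F : Fin (a * b) → ℕ
    F = f ∘ remQuot b
    π : Permutation m (a * b)
    π = ↔-sym *↔× ↔-∘ ⤖⇒↔ ψ

  -- count p and countP G p unfold to sumF (ind ∘ p) and sum× (ind ∘ p).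
  ind : Bool → ℕ
  ind b = if b then 1 else 0

  _∖_ : Bool → Bool → Bool
  a ∖ e = a ∧ not e

  ind-∧ : ∀ a b → ind (a ∧ b) ≡ ind a * ind b
  ind-∧ false b = refl
  ind-∧ true  b = sym (+-identityʳ (ind b))

  ind-interchange : ∀ a b c d → ind ((a ∧ b) ∧ (c ∧ d)) ≡ ind (a ∧ c) * ind (b ∧ d)
  ind-interchange a b c d = trans (cong ind (interchange a b c d)) (ind-∧ (a ∧ c) (b ∧ d))

  ind≤ind-∖+ind : ∀ a e → ind a ≤ ind (a ∖ e) + ind e
  ind≤ind-∖+ind false e     = z≤n
  ind≤ind-∖+ind true  true  = s≤s z≤n
  ind≤ind-∖+ind true  false = s≤s z≤n

  ind-∖∧∖≤ind-∧ : ∀ a e b f → ind ((a ∖ e) ∧ (b ∖ f)) ≤ ind (a ∧ b)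
  ind-∖∧∖≤ind-∧ false e     b     f     = z≤n
  ind-∖∧∖≤ind-∧ true  true  b     f     = z≤n
  ind-∖∧∖≤ind-∧ true  false false f     = z≤n
  ind-∖∧∖≤ind-∧ true  false true  true  = z≤n
  ind-∖∧∖≤ind-∧ true  false true  false = s≤s z≤n

  ind-∧≤ind-∖∧∖+ : ∀ a e b f → ind (a ∧ b) ≤ ind ((a ∖ e) ∧ (b ∖ f)) + (ind e + ind f)
  ind-∧≤ind-∖∧∖+ false e     b     f     = z≤n
  ind-∧≤ind-∖∧∖+ true  e     false f     = z≤n
  ind-∧≤ind-∖∧∖+ true  true  true  f     = s≤s z≤n
  ind-∧≤ind-∖∧∖+ true  false true  true  = s≤s z≤n
  ind-∧≤ind-∖∧∖+ true  false true  false = s≤s z≤n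

open Counting

open import Defs hiding (sym)
open import Data.Nat using (ℕ)
open import Data.Fin using (Fin)
open import Data.Bool using (Bool; _∧_)
open import Data.Product using (_×_; _,_; proj₁; proj₂)
open import Data.Integer using (+_)
open import Data.Rational using (ℚ; _/_; _≤_; _*_; _-_; 0ℚ)
open import Function using (_∘_)
open import Function.Bundles using (Bijection; _⤖_)
import Data.Nat as N
import Data.Nat.Properties as N
import Data.Integer as ℤ
import Data.Integer.Properties as ℤ
open import Data.Nat.Coprimality using (1-coprimeTo)
import Data.Nat.Coprimality as Coprime
open import Data.Rational using (mkℚ; _+_; -_; *≤*; nonNegative)
open import Data.Rational.Properties
  using (≤-reflexive; ≤-trans; +-mono-≤; +-monoˡ-≤; +-monoʳ-≤; +-identityʳ; +-inverseʳ;
         *-monoˡ-≤-nonNeg; nonNegative⁻¹; nonNeg+nonNeg⇒nonNeg; nonNeg*nonNeg⇒nonNeg;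
         normalize-nonNeg; normalize-coprime; module ≤-Reasoning)
open import Data.Rational.Solver using (module +-*-Solver)
open +-*-Solver using (solve; _:+_; _:*_; _:-_; con; _:=_)
open import Relation.Binary.PropositionalEquality

ℕtoℚ≡mkℚ : ∀ k → ℕtoℚ k ≡ mkℚ (+ k) 0 (Coprime.sym (1-coprimeTo k))
ℕtoℚ≡mkℚ k = normalize-coprime (Coprime.sym (1-coprimeTo k))

ℕtoℚ-+ : ∀ m n → ℕtoℚ (m N.+ n) ≡ ℕtoℚ m + ℕtoℚ n
ℕtoℚ-+ m n rewrite ℕtoℚ≡mkℚ m | ℕtoℚ≡mkℚ n =
  cong (_/ 1) (sym (cong₂ ℤ._+_ (ℤ.*-identityʳ (+ m)) (ℤ.*-identityʳ (+ n))))

ℕtoℚ-mono : ∀ {m n} → m N.≤ n → ℕtoℚ m ≤ ℕtoℚ n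
ℕtoℚ-mono {m} {n} m≤n rewrite ℕtoℚ≡mkℚ m | ℕtoℚ≡mkℚ n =
  *≤* (subst₂ ℤ._≤_ (sym (ℤ.*-identityʳ (+ m))) (sym (ℤ.*-identityʳ (+ n))) (ℤ.+≤+ m≤n))

ℕtoℚ-nonNeg : ∀ k → 0ℚ ≤ ℕtoℚ k
ℕtoℚ-nonNeg k = nonNegative⁻¹ _ {{normalize-nonNeg k 1}}

+-pres-0≤ : ∀ {p q} → 0ℚ ≤ p → 0ℚ ≤ q → 0ℚ ≤ p + q
+-pres-0≤ {p} {q} 0≤p 0≤q = nonNegative⁻¹ _ {{nonNeg+nonNeg⇒nonNeg p {{nonNegative 0≤p}} q {{nonNegative 0≤q}}}}

*-pres-0≤ : ∀ {p q} → 0ℚ ≤ p → 0ℚ ≤ q → 0ℚ ≤ p * q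
*-pres-0≤ {p} {q} 0≤p 0≤q = nonNegative⁻¹ _ {{nonNeg*nonNeg⇒nonNeg p {{nonNegative 0≤p}} q {{nonNegative 0≤q}}}}

p≤q⇒0≤q-p : ∀ {p q} → p ≤ q → 0ℚ ≤ q - p
p≤q⇒0≤q-p {p} {q} p≤q = ≤-trans (≤-reflexive (sym (+-inverseʳ p))) (+-monoˡ-≤ (- p) p≤q)

0≤q-p⇒p≤q : ∀ {p q} → 0ℚ ≤ q - p → p ≤ q
0≤q-p⇒p≤q {p} {q} 0≤q-p = begin
  p            ≡⟨ sym (+-identityʳ p) ⟩
  p + 0ℚ       ≤⟨ +-monoʳ-≤ p 0≤q-p ⟩
  p + (q - p)  ≡⟨ solve 2 (λ p q → p :+ (q :- p) := q) refl p q ⟩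
  q            ∎
  where open ≤-Reasoning

p≤q+r⇒p-r≤q : ∀ {p q r} → p ≤ q + r → p - r ≤ q
p≤q+r⇒p-r≤q {p} {q} {r} p≤q+r = 0≤q-p⇒p≤q (subst (0ℚ ≤_) q+r-p≡q-[p-r] (p≤q⇒0≤q-p p≤q+r))
  where
  q+r-p≡q-[p-r] : (q + r) - p ≡ q - (p - r)
  q+r-p≡q-[p-r] = solve 3 (λ p q r → (q :+ r) :- p := q :- (p :- r)) refl p q r

absorb-≤ : ∀ {ε a h h'} → 0ℚ ≤ ε → ε ≤ (+ 1) / 3 → 0ℚ ≤ a → h' ≤ h →
           a ≤ ε * (h' + a) → a ≤ (+ 3) / 2 * ε * h
absorb-≤ {ε} {a} {h} {h'} 0≤ε ε≤⅓ 0≤a h'≤h a≤ε[h'+a] =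
  0≤q-p⇒p≤q (subst (0ℚ ≤_) (sym certificate)
    (*-pres-0≤ (nonNegative⁻¹ _ {{normalize-nonNeg 3 2}})
      (+-pres-0≤ (+-pres-0≤ (p≤q⇒0≤q-p a≤ε[h'+a]) (*-pres-0≤ 0≤a (p≤q⇒0≤q-p ε≤⅓))) (*-pres-0≤ 0≤ε (p≤q⇒0≤q-p h'≤h)))))
  where
  certificate : (+ 3) / 2 * ε * h - a ≡
                (+ 3) / 2 * ((ε * (h' + a) - a) + a * ((+ 1) / 3 - ε) + ε * (h - h'))
  certificate = solve 4 (λ ε a h h' →
    con ((+ 3) / 2) :* ε :* h :- a :=
    con ((+ 3) / 2) :* ((ε :* (h' :+ a) :- a) :+ a :* (con ((+ 1) / 3) :- ε) :+ ε :* (h :- h'))) refl ε a h h'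

commonP : (G : Graph) → VP G → VP G → ℕ
commonP G x y = countP G (λ z → adjP G x z ∧ adjP G y z)

commonP-tensor : ∀ G x y →
  commonP G x y ≡ common K3 (proj₁ x) (proj₁ y) N.* common G (proj₂ x) (proj₂ y)
commonP-tensor G (t₁ , g₁) (t₂ , g₂) =
  trans (sumF-cong (λ t → sumF-cong (λ g →
           ind-interchange (adj K3 t₁ t) (adj G g₁ g) (adj K3 t₂ t) (adj G g₂ g))))
        (sum×-* (λ t → ind (adj K3 t₁ t ∧ adj K3 t₂ t)) (λ g → ind (adj G g₁ g ∧ adj G g₂ g)))

module _ {G ε H E'} {ψ : Fin (n H) ⤖ VP G} (near : NearVia G ε H E' ψ) where
  open NearVia near
  private module ψ = Bijection ψ

  deleted : VP G → ℕ
  deleted x = countP G (E' x)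

  adjP∖E' : VP G → VP G → Bool
  adjP∖E' x z = adjP G x z ∖ E' x z

  deg-via-ψ : ∀ a → deg H a ≡ countP G (adjP∖E' (ψ.to a))
  deg-via-ψ a = trans (sumF-cong (λ w → cong ind (ψ-iso a w))) (sumF-∘-⤖ ψ (ind ∘ adjP∖E' (ψ.to a)))

  common-via-ψ : ∀ a b → common H a b ≡ countP G (λ z → adjP∖E' (ψ.to a) z ∧ adjP∖E' (ψ.to b) z)
  common-via-ψ a b =
    trans (sumF-cong (λ w → cong ind (cong₂ _∧_ (ψ-iso a w) (ψ-iso b w))))
          (sumF-∘-⤖ ψ (λ z → ind (adjP∖E' (ψ.to a) z ∧ adjP∖E' (ψ.to b) z)))

  common≤commonP : ∀ a b → common H a b N.≤ commonP G (ψ.to a) (ψ.to b)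
  common≤commonP a b = begin
    common H a b
      ≡⟨ common-via-ψ a b ⟩
    countP G (λ z → adjP∖E' x z ∧ adjP∖E' y z)
      ≤⟨ sum×-mono (λ z → ind-∖∧∖≤ind-∧ (adjP G x z) (E' x z) (adjP G y z) (E' y z)) ⟩
    commonP G x y ∎
    where
    open N.≤-Reasoning
    x = ψ.to a
    y = ψ.to b

  commonP≤common+deleted : ∀ a b →
    commonP G (ψ.to a) (ψ.to b) N.≤ common H a b N.+ (deleted (ψ.to a) N.+ deleted (ψ.to b))
  commonP≤common+deleted a b = begin
    commonP G x y
      ≤⟨ sum×-mono (λ z → ind-∧≤ind-∖∧∖+ (adjP G x z) (E' x z) (adjP G y z) (E' y z)) ⟩
    sum× (λ z → ind (adjP∖E' x z ∧ adjP∖E' y z) N.+ (ind (E' x z) N.+ ind (E' y z)))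
      ≡⟨ sum×-+ (λ z → ind (adjP∖E' x z ∧ adjP∖E' y z)) (λ z → ind (E' x z) N.+ ind (E' y z)) ⟩
    countP G (λ z → adjP∖E' x z ∧ adjP∖E' y z) N.+ sum× (λ z → ind (E' x z) N.+ ind (E' y z))
      ≡⟨ cong₂ N._+_ (sym (common-via-ψ a b)) (sum×-+ (ind ∘ E' x) (ind ∘ E' y)) ⟩
    common H a b N.+ (deleted x N.+ deleted y) ∎
    where
    open N.≤-Reasoning
    x = ψ.to a
    y = ψ.to b

  degP≤deg+deleted : ∀ a → degP G (ψ.to a) N.≤ deg H a N.+ deleted (ψ.to a)
  degP≤deg+deleted a = begin
    degP G x
      ≤⟨ sum×-mono (λ z → ind≤ind-∖+ind (adjP G x z) (E' x z)) ⟩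
    sum× (λ z → ind (adjP∖E' x z) N.+ ind (E' x z))
      ≡⟨ sum×-+ (ind ∘ adjP∖E' x) (ind ∘ E' x) ⟩
    countP G (adjP∖E' x) N.+ deleted x
      ≡⟨ cong (N._+ deleted x) (sym (deg-via-ψ a)) ⟩
    deg H a N.+ deleted x ∎
    where
    open N.≤-Reasoning
    x = ψ.to a

  deleted≤ : 0ℚ ≤ ε → ε ≤ (+ 1) / 3 → ∀ {a b} → deg H a N.≤ deg H b →
             ℕtoℚ (deleted (ψ.to a)) ≤ (+ 3) / 2 * ε * ℕtoℚ (deg H b)
  deleted≤ 0≤ε ε≤⅓ {a} deg-a≤deg-b =
    absorb-≤ 0≤ε ε≤⅓ (ℕtoℚ-nonNeg (deleted x)) (ℕtoℚ-mono deg-a≤deg-b) (begin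
      ℕtoℚ (deleted x)                            ≤⟨ E'-bound x ⟩
      ε * ℕtoℚ (degP G x)                          ≤⟨ *-monoˡ-≤-nonNeg ε {{nonNegative 0≤ε}} (ℕtoℚ-mono (degP≤deg+deleted a)) ⟩
      ε * ℕtoℚ (deg H a N.+ deleted x)             ≡⟨ cong (ε *_) (ℕtoℚ-+ (deg H a) (deleted x)) ⟩
      ε * (ℕtoℚ (deg H a) + ℕtoℚ (deleted x))      ∎)
    where
    open ≤-Reasoning
    x = ψ.to a

proposition2p8 : (G : Graph) (ε : ℚ) → 0ℚ ≤ ε → ε ≤ (+ 1) / 3 →
  (H : Graph) (E' : VP G → VP G → Bool) (ψ : Fin (n H) ⤖ VP G) →
  NearVia G ε H E' ψ →
  (u v : Fin (n H)) → deg H v N.≤ deg H u →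
  let t₁ = proj₁ (Bijection.to ψ u)
      g₁ = proj₂ (Bijection.to ψ u)
      t₂ = proj₁ (Bijection.to ψ v)
      g₂ = proj₂ (Bijection.to ψ v)
      c  = common K3 t₁ t₂ N.* common G g₁ g₂
  in (ℕtoℚ c - ((+ 3) / 1) * ε * ℕtoℚ (deg H u) ≤ ℕtoℚ (common H u v))
     × (common H u v N.≤ c)
proposition2p8 G ε 0≤ε ε≤⅓ H E' ψ near u v deg-v≤deg-u = lower , upper
  where
  x = Bijection.to ψ u
  y = Bijection.to ψ v
  h = ℕtoℚ (deg H u)
  m = ℕtoℚ (common H u v)
  c = common K3 (proj₁ x) (proj₁ y) N.* common G (proj₂ x) (proj₂ y)

  upper : common H u v N.≤ c
  upper = subst (common H u v N.≤_) (commonP-tensor G x y) (common≤commonP near u v)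

  twice-three-halves : (+ 3) / 2 * ε * h + (+ 3) / 2 * ε * h ≡ (+ 3) / 1 * ε * h
  twice-three-halves = solve 2 (λ ε h →
    con ((+ 3) / 2) :* ε :* h :+ con ((+ 3) / 2) :* ε :* h := con ((+ 3) / 1) :* ε :* h) refl ε h

  lower : ℕtoℚ c - (+ 3) / 1 * ε * h ≤ m
  lower = p≤q+r⇒p-r≤q (begin
    ℕtoℚ c
      ≡⟨ cong ℕtoℚ (sym (commonP-tensor G x y)) ⟩
    ℕtoℚ (commonP G x y)
      ≤⟨ ℕtoℚ-mono (commonP≤common+deleted near u v) ⟩
    ℕtoℚ (common H u v N.+ (deleted near x N.+ deleted near y))
      ≡⟨ trans (ℕtoℚ-+ (common H u v) _) (cong (_+_ m) (ℕtoℚ-+ (deleted near x) (deleted near y))) ⟩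
    m + (ℕtoℚ (deleted near x) + ℕtoℚ (deleted near y))
      ≤⟨ +-monoʳ-≤ m
           (+-mono-≤ (deleted≤ near 0≤ε ε≤⅓ N.≤-refl) (deleted≤ near 0≤ε ε≤⅓ deg-v≤deg-u)) ⟩
    m + ((+ 3) / 2 * ε * h + (+ 3) / 2 * ε * h)
      ≡⟨ cong (_+_ m) twice-three-halves ⟩
    m + (+ 3) / 1 * ε * h ∎)
    where open ≤-Reasoning
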